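{- Let $q\ge2$, $n\ge 2$, let $S=(s_i)$ be a negative orientable sequence of order $n$ over $\mathbb{Z}_q$, and let $\mathbf{v}=(v_0,\ldots,v_{n-2})$ be a negasymmetric $(n-1)$-tuple over $\mathbb{Z}_q$. Let $L(\mathbf{v})$ be the set of $n$-tuples $(u_0,\ldots,u_{n-1})$ over $\mathbb{Z}_q$ with $u_i=v_i$ for $0\le i\le n-2$, and let $L^*_S(\mathbf{v})$ be the set of those $\mathbf{u}\in L(\mathbf{v})$ that appear (as $n$ consecutive terms) in $S$ or in $-S^R$. Then $|L^*_S(\mathbf{v})|$ is even.
   Context: Sequences are periodic with entries in $\mathbb{Z}_q$. For $S=(s_i)$ write $\mathbf{s}_n(i)=(s_i,\ldots,s_{i+n-1})$; for an $n$-tuple $\mathbf{u}=(u_0,\ldots,u_{n-1})$ let $\mathbf{u}^R=(u_{n-1},\ldots,u_0)$ and $-\mathbf{u}=(-u_0,\ldots,-u_{n-1})$. $-S^R$ denotes the sequence obtained from $S$ by reversing the order of terms and negating each term. A periodic sequence of period $m$ is an $n$-window sequence if $\mathbf{s}_n(i)=\mathbf{s}_n(j)$ implies $i\equiv j\pmod m$; it is a negative orientable sequence of order $n$ if also $\mathbf{s}_n(i)\neq-\mathbf{s}_n(j)^R$ for all $i,j$. A $k$-tuple $(v_0,\ldots,v_{k-1})$ is negasymmetric if $v_i=-v_{k-1-i}$ for all $i$. -}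

module Defs where

open import Data.Nat using (ℕ; suc; _+_; _∸_; NonZero)
open import Data.Nat.DivMod using (_mod_)
open import Data.Fin using (Fin; toℕ; opposite; inject₁)
open import Data.Vec using (Vec; tabulate; lookup; reverse; map)
open import Data.Product using (∃; _×_)
open import Data.Sum using (_⊎_)
open import Relation.Binary.PropositionalEquality using (_≡_; _≢_)

-- ℤ_q represented by Fin q; negation modulo q.
neg : {q : ℕ} .{{_ : NonZero q}} → Fin q → Fin q
neg {q} x = (q ∸ toℕ x) mod q

negV : {q n : ℕ} .{{_ : NonZero q}} → Vec (Fin q) n → Vec (Fin q) n
negV = map neg

-- A periodic sequence of period m is given by one period S : Fin m → Fin q.
-- Window s_n(i) = (s_i, ..., s_{i+n-1}), indices taken mod m.
window : {q m : ℕ} .{{_ : NonZero m}} → (Fin m → Fin q) → (n : ℕ) → Fin m → Vec (Fin q) n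
window {m = m} S n i = tabulate (λ k → S ((toℕ i + toℕ k) mod m))

negRev : {q m : ℕ} .{{_ : NonZero q}} → (Fin m → Fin q) → (Fin m → Fin q)
negRev S i = neg (S (opposite i))

IsWindowSeq : {q m : ℕ} .{{_ : NonZero m}} → (Fin m → Fin q) → ℕ → Set
IsWindowSeq S n = ∀ i j → window S n i ≡ window S n j → i ≡ j

IsNegOrientable : {q m : ℕ} .{{_ : NonZero q}} .{{_ : NonZero m}} → (Fin m → Fin q) → ℕ → Set
IsNegOrientable S n =
  IsWindowSeq S n × (∀ i j → window S n i ≢ negV (reverse (window S n j)))

Negasymmetric : {q k : ℕ} .{{_ : NonZero q}} → Vec (Fin q) k → Set
Negasymmetric {k = k} v = ∀ (i : Fin k) → lookup v i ≡ neg (lookup v (opposite i))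

InL : {q k : ℕ} → Vec (Fin q) k → Vec (Fin q) (suc k) → Set
InL {k = k} v u = ∀ (i : Fin k) → lookup u (inject₁ i) ≡ lookup v i

AppearsIn : {q m n : ℕ} .{{_ : NonZero m}} → (Fin m → Fin q) → Vec (Fin q) n → Set
AppearsIn {n = n} S u = ∃ λ i → window S n i ≡ u

InLStar : {q m k : ℕ} .{{_ : NonZero q}} .{{_ : NonZero m}} →
          (Fin m → Fin q) → Vec (Fin q) k → Vec (Fin q) (suc k) → Set
InLStar S v u = InL v u × (AppearsIn S u ⊎ AppearsIn (negRev S) u)

{-# OPTIONS --safe #-}
module Submission where

-- Write n = k + 1 and T = -S^R, so that T(p) = -S(m-1-p).  Reversing and negating the
-- L-window of S at i gives the L-window of T at the position j ≡ -(i + L) (mod m).  As v is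
-- negasymmetric, v occurs at i in S exactly when it occurs at j in T, so the n-tuples of
-- L*_S(v) are the n-windows of S at the occurrences i of v in S together with the n-windows
-- of T at the corresponding positions j.  The window property of S (which T inherits) makes
-- each family repetition-free, and negative orientability makes the two families disjoint,
-- so |L*_S(v)| is twice the number of occurrences of v in S.

open import Defs
open import Data.Nat using (ℕ; suc; _≤_; NonZero)
open import Data.Nat.Divisibility using (_∣_)
open import Data.Fin using (Fin)
open import Data.Vec using (Vec)
open import Data.List using (List; length)
open import Data.List.Relation.Unary.Unique.Propositional using (Unique)
open import Data.List.Membership.Propositional using (_∈_)
open import Function.Bundles using (_⇔_)

open import Data.Nat using (zero; _+_; _*_; _∸_; _%_; _/_)
open import Data.Nat.Properties using (+-comm; *-comm; +-identityʳ; +-suc; m+[n∸m]≡n; <⇒≤)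
open import Data.Nat.DivMod using (_mod_; m≡m%n+[m/n]*n; %-remove-+ˡ; m<n⇒m%n≡m; m%n<n)
open import Data.Nat.Divisibility using (divides; ∣-refl; n∣m*n; ∣m+n∣m⇒∣n; ∣m∣n⇒∣m+n)
open import Data.Nat.Tactic.RingSolver using (solve-∀)
open import Data.Fin using (zero; suc; toℕ; fromℕ; inject₁; opposite)
open import Data.Fin.Properties
  using (_≟_; toℕ-injective; toℕ-fromℕ<; toℕ<n; toℕ-inject₁; opposite-prop; opposite-involutive)
open import Data.Vec using (_∷_; tabulate; lookup; reverse; _∷ʳ_)
open import Data.Vec.Properties
  using (≡-dec; tabulate-cong; tabulate-∘; tabulate∘lookup; lookup∘tabulate; reverse-∷)
open import Data.List using (map; filter; allFin; _++_)
open import Data.List.Properties using (length-++; length-map)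
open import Data.List.Membership.Propositional.Properties
  using (∈-map⁻; ∈-map⁺; ∈-filter⁻; ∈-filter⁺; ∈-allFin; ∈-++⁻; ∈-++⁺ˡ; ∈-++⁺ʳ)
open import Data.List.Membership.Propositional.Properties.WithK using (unique∧set⇒bag)
open import Data.List.Relation.Binary.BagAndSetEquality using (∼bag⇒↭)
open import Data.List.Relation.Binary.Disjoint.Propositional using (Disjoint)
open import Data.List.Relation.Binary.Permutation.Propositional.Properties using (↭-length)
open import Data.List.Relation.Unary.Unique.Propositional.Properties
  using (++⁺; map⁺; filter⁺; allFin⁺)
open import Data.Product using (_,_; proj₂)
open import Data.Sum using (inj₁; inj₂)
open import Function.Base using (_∘_)
open import Function.Bundles using (Equivalence; mk⇔)
open import Function.Properties.Equivalence using () renaming (sym to ⇔-sym; trans to ⇔-trans)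
open import Relation.Nullary using (Dec)
open import Relation.Binary.PropositionalEquality
  using (_≡_; refl; sym; trans; cong; cong₂; subst; module ≡-Reasoning)

open Equivalence using (to; from)

unique∧set⇒length≡ : ∀ {A : Set} {xs ys : List A} → Unique xs → Unique ys →
                     (∀ {x} → x ∈ xs ⇔ x ∈ ys) → length xs ≡ length ys
unique∧set⇒length≡ xs! ys! same = ↭-length (∼bag⇒↭ (unique∧set⇒bag xs! ys! same))

opposite-fromℕ : ∀ n → opposite (fromℕ n) ≡ zero
opposite-fromℕ zero    = refl
opposite-fromℕ (suc n) = cong inject₁ (opposite-fromℕ n)

opposite-inject₁ : ∀ {n} (i : Fin n) → opposite (inject₁ i) ≡ suc (opposite i)
opposite-inject₁ {suc n} zero    = refl
opposite-inject₁ {suc n} (suc i) = cong inject₁ (opposite-inject₁ i)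

module _ {A : Set} where

  lookup-≗⇒≡ : ∀ {n} {xs ys : Vec A n} → (∀ i → lookup xs i ≡ lookup ys i) → xs ≡ ys
  lookup-≗⇒≡ {xs = xs} {ys} eq = begin
    xs                   ≡⟨ tabulate∘lookup xs ⟨
    tabulate (lookup xs) ≡⟨ tabulate-cong eq ⟩
    tabulate (lookup ys) ≡⟨ tabulate∘lookup ys ⟩
    ys                   ∎
    where open ≡-Reasoning

  tabulate-∷ʳ : ∀ {n} (f : Fin (suc n) → A) → tabulate f ≡ tabulate (f ∘ inject₁) ∷ʳ f (fromℕ n)
  tabulate-∷ʳ {zero}  f = refl
  tabulate-∷ʳ {suc n} f = cong (f zero ∷_) (tabulate-∷ʳ (f ∘ suc))

  reverse-tabulate : ∀ {n} (f : Fin n → A) → reverse (tabulate f) ≡ tabulate (f ∘ opposite)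
  reverse-tabulate {zero}  f = refl
  reverse-tabulate {suc n} f = begin
    reverse (tabulate f)                    ≡⟨ reverse-∷ (f zero) (tabulate (f ∘ suc)) ⟩
    reverse (tabulate (f ∘ suc)) ∷ʳ f zero  ≡⟨ cong (_∷ʳ f zero) (reverse-tabulate (f ∘ suc)) ⟩
    tabulate (f ∘ suc ∘ opposite) ∷ʳ f zero ≡⟨ cong₂ _∷ʳ_ (tabulate-cong (cong f ∘ opposite-inject₁))
                                                          (cong f (opposite-fromℕ n)) ⟨
    tabulate (f ∘ opposite ∘ inject₁) ∷ʳ f (opposite (fromℕ n)) ≡⟨ tabulate-∷ʳ (f ∘ opposite) ⟨
    tabulate (f ∘ opposite)                 ∎
    where open ≡-Reasoning

module _ {d : ℕ} .{{_ : NonZero d}} where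

  toℕ-mod : ∀ n → toℕ (n mod d) ≡ n % d
  toℕ-mod n = toℕ-fromℕ< (m%n<n n d)

  ∣m+n⇒∣m+n%d : ∀ m n → d ∣ m + n → d ∣ m + n % d
  ∣m+n⇒∣m+n%d m n d∣m+n = ∣m+n∣m⇒∣n (subst (d ∣_) eq d∣m+n) (n∣m*n (n / d))
    where
    rearrange : ∀ a b c → a + (b + c) ≡ c + (a + b)
    rearrange = solve-∀
    eq : m + n ≡ n / d * d + (m + n % d)
    eq = trans (cong (m +_) (m≡m%n+[m/n]*n n d)) (rearrange m (n % d) (n / d * d))

  ∣m%d+n⇒∣m+n : ∀ m n → d ∣ m % d + n → d ∣ m + n
  ∣m%d+n⇒∣m+n m n d∣m%d+n = subst (d ∣_) (sym eq) (∣m∣n⇒∣m+n (n∣m*n (m / d)) d∣m%d+n)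
    where
    rearrange : ∀ a b c → (a + c) + b ≡ c + (a + b)
    rearrange = solve-∀
    eq : m + n ≡ m / d * d + (m % d + n)
    eq = trans (cong (_+ n) (m≡m%n+[m/n]*n m d)) (rearrange (m % d) n (m / d * d))

  ∣m+i∧∣m+j⇒i≡j : ∀ m (i j : Fin d) → d ∣ m + toℕ i → d ∣ m + toℕ j → i ≡ j
  ∣m+i∧∣m+j⇒i≡j m i j d∣m+i d∣m+j = toℕ-injective (begin
    toℕ i                   ≡⟨ m<n⇒m%n≡m (toℕ<n i) ⟨
    toℕ i % d               ≡⟨ %-remove-+ˡ (toℕ i) d∣m+j ⟨
    (m + toℕ j + toℕ i) % d ≡⟨ cong (_% d) (rearrange m (toℕ j) (toℕ i)) ⟩
    (m + toℕ i + toℕ j) % d ≡⟨ %-remove-+ˡ (toℕ j) d∣m+i ⟩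
    toℕ j % d               ≡⟨ m<n⇒m%n≡m (toℕ<n j) ⟩
    toℕ j                   ∎)
    where
    open ≡-Reasoning
    rearrange : ∀ a b c → a + b + c ≡ a + c + b
    rearrange = solve-∀

  ∣i+neg[i] : ∀ (i : Fin d) → d ∣ toℕ i + toℕ (neg i)
  ∣i+neg[i] i = subst (λ n → d ∣ toℕ i + n) (sym (toℕ-mod (d ∸ toℕ i)))
    (∣m+n⇒∣m+n%d (toℕ i) (d ∸ toℕ i) (subst (d ∣_) (sym (m+[n∸m]≡n (<⇒≤ (toℕ<n i)))) ∣-refl))

  neg-involutive : ∀ (i : Fin d) → neg (neg i) ≡ i
  neg-involutive i = ∣m+i∧∣m+j⇒i≡j (toℕ (neg i)) (neg (neg i)) i
    (∣i+neg[i] (neg i)) (subst (d ∣_) (+-comm (toℕ i) (toℕ (neg i))) (∣i+neg[i] i))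

  opposite-mod : ∀ m n → d ∣ suc (m + n) → opposite (m mod d) ≡ n mod d
  opposite-mod m n d∣1+m+n = ∣m+i∧∣m+j⇒i≡j (suc m) (opposite (m mod d)) (n mod d)
    (subst (d ∣_) (+-suc m _) (∣m%d+n⇒∣m+n m _ (subst (d ∣_) (sym m%d+1+opp≡d) ∣-refl)))
    (subst (λ r → d ∣ suc m + r) (sym (toℕ-mod n)) (∣m+n⇒∣m+n%d (suc m) n d∣1+m+n))
    where
    open ≡-Reasoning
    m%d+1+opp≡d : m % d + suc (toℕ (opposite (m mod d))) ≡ d
    m%d+1+opp≡d = begin
      m % d + suc (toℕ (opposite (m mod d)))  ≡⟨ +-suc (m % d) _ ⟩
      suc (m % d) + toℕ (opposite (m mod d))  ≡⟨ cong (suc (m % d) +_) (opposite-prop (m mod d)) ⟩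
      suc (m % d) + (d ∸ suc (toℕ (m mod d))) ≡⟨ cong (λ r → suc (m % d) + (d ∸ suc r)) (toℕ-mod m) ⟩
      suc (m % d) + (d ∸ suc (m % d))         ≡⟨ m+[n∸m]≡n (m%n<n m d) ⟩
      d                                       ∎

  Opposed : ℕ → Fin d → Fin d → Set
  Opposed L i j = d ∣ toℕ i + L + toℕ j

  opposed-sym : ∀ {L i j} → Opposed L i j → Opposed L j i
  opposed-sym {L} {i} {j} = subst (d ∣_) (rearrange (toℕ i) L (toℕ j))
    where
    rearrange : ∀ a b c → a + b + c ≡ c + b + a
    rearrange = solve-∀

  opposed-unique : ∀ {L i j j′} → Opposed L i j → Opposed L i j′ → j ≡ j′
  opposed-unique {L} {i} = ∣m+i∧∣m+j⇒i≡j (toℕ i + L) _ _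

  mirror : ℕ → Fin d → Fin d
  mirror L i = neg ((toℕ i + L) mod d)

  opposed-mirror : ∀ L i → Opposed L i (mirror L i)
  opposed-mirror L i = ∣m%d+n⇒∣m+n (toℕ i + L) _
    (subst (λ r → d ∣ r + toℕ (mirror L i)) (toℕ-mod (toℕ i + L)) (∣i+neg[i] ((toℕ i + L) mod d)))

  mirror-involutive : ∀ L i → mirror L (mirror L i) ≡ i
  mirror-involutive L i = opposed-unique {L} {mirror L i}
    (opposed-mirror L (mirror L i)) (opposed-sym {L} {i} (opposed-mirror L i))

  mirror-injective : ∀ L {i j} → mirror L i ≡ mirror L j → i ≡ j
  mirror-injective L {i} {j} e = begin
    i                     ≡⟨ mirror-involutive L i ⟨
    mirror L (mirror L i) ≡⟨ cong (mirror L) e ⟩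
    mirror L (mirror L j) ≡⟨ mirror-involutive L j ⟩
    j                     ∎
    where open ≡-Reasoning

negRevV : ∀ {q n} .{{_ : NonZero q}} → Vec (Fin q) n → Vec (Fin q) n
negRevV w = negV (reverse w)

module _ {q : ℕ} .{{_ : NonZero q}} where

  negRevV-tabulate : ∀ {n} (f : Fin n → Fin q) → negRevV (tabulate f) ≡ tabulate (neg ∘ f ∘ opposite)
  negRevV-tabulate f = trans (cong negV (reverse-tabulate f)) (sym (tabulate-∘ neg (f ∘ opposite)))

  negRevV-involutive : ∀ {n} (w : Vec (Fin q) n) → negRevV (negRevV w) ≡ w
  negRevV-involutive w = begin
    negRevV (negRevV w)                                   ≡⟨ cong (negRevV ∘ negRevV) (tabulate∘lookup w) ⟨
    negRevV (negRevV (tabulate (lookup w)))               ≡⟨ cong negRevV (negRevV-tabulate (lookup w)) ⟩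
    negRevV (tabulate (neg ∘ lookup w ∘ opposite))        ≡⟨ negRevV-tabulate (neg ∘ lookup w ∘ opposite) ⟩
    tabulate (neg ∘ neg ∘ lookup w ∘ opposite ∘ opposite) ≡⟨ tabulate-cong neg-neg-opp-opp ⟩
    tabulate (lookup w)                                   ≡⟨ tabulate∘lookup w ⟩
    w                                                     ∎
    where
    open ≡-Reasoning
    neg-neg-opp-opp : ∀ t → neg (neg (lookup w (opposite (opposite t)))) ≡ lookup w t
    neg-neg-opp-opp t = trans (neg-involutive _) (cong (lookup w) (opposite-involutive t))

  negRevV-injective : ∀ {n} {w w′ : Vec (Fin q) n} → negRevV w ≡ negRevV w′ → w ≡ w′
  negRevV-injective {w = w} {w′} e = begin
    w                    ≡⟨ negRevV-involutive w ⟨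
    negRevV (negRevV w)  ≡⟨ cong negRevV e ⟩
    negRevV (negRevV w′) ≡⟨ negRevV-involutive w′ ⟩
    w′                   ∎
    where open ≡-Reasoning

  negasymmetric⇒negRevV≡ : ∀ {n} {v : Vec (Fin q) n} → Negasymmetric v → negRevV v ≡ v
  negasymmetric⇒negRevV≡ {v = v} negasym = begin
    negRevV v                            ≡⟨ cong negRevV (tabulate∘lookup v) ⟨
    negRevV (tabulate (lookup v))        ≡⟨ negRevV-tabulate (lookup v) ⟩
    tabulate (neg ∘ lookup v ∘ opposite) ≡⟨ tabulate-cong (sym ∘ negasym) ⟩
    tabulate (lookup v)                  ≡⟨ tabulate∘lookup v ⟩
    v                                    ∎
    where open ≡-Reasoning

module _ {q m : ℕ} .{{_ : NonZero q}} .{{_ : NonZero m}} where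

  InL-window : ∀ {k} (v : Vec (Fin q) k) (f : Fin m → Fin q) i →
               InL v (window f (suc k) i) ⇔ window f k i ≡ v
  InL-window {k} v f i = mk⇔
    (λ inL → lookup-≗⇒≡ (λ t → trans (sym (lookup-inject₁ t)) (inL t)))
    (λ e t → trans (lookup-inject₁ t) (cong (λ w → lookup w t) e))
    where
    open ≡-Reasoning
    f[i+_] : ∀ {n} → Fin n → Fin q
    f[i+_] t = f ((toℕ i + toℕ t) mod m)
    lookup-inject₁ : ∀ t → lookup (window f (suc k) i) (inject₁ t) ≡ lookup (window f k i) t
    lookup-inject₁ t = begin
      lookup (window f (suc k) i) (inject₁ t) ≡⟨ lookup∘tabulate f[i+_] (inject₁ t) ⟩
      f ((toℕ i + toℕ (inject₁ t)) mod m)     ≡⟨ cong (λ n → f ((toℕ i + n) mod m)) (toℕ-inject₁ t) ⟩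
      f ((toℕ i + toℕ t) mod m)               ≡⟨ lookup∘tabulate f[i+_] t ⟨
      lookup (window f k i) t                 ∎

  module _ (S : Fin m → Fin q) where

    window-negRev : ∀ {L i j} → Opposed L i j → window (negRev S) L j ≡ negRevV (window S L i)
    window-negRev {L} {i} {j} i+L+j≡0 = begin
      window (negRev S) L j
        ≡⟨ tabulate-cong (cong (neg ∘ S) ∘ opposite-mod _ _ ∘ ∣1+[j+t]+[i+opp[t]]) ⟩
      tabulate (λ t → neg (S ((toℕ i + toℕ (opposite t)) mod m)))
        ≡⟨ negRevV-tabulate _ ⟨
      negRevV (window S L i)
        ∎
      where
      open ≡-Reasoning
      rearrange : ∀ a b c r → suc (c + b + (a + r)) ≡ a + (suc b + r) + c
      rearrange = solve-∀
      ∣1+[j+t]+[i+opp[t]] : ∀ t → m ∣ suc (toℕ j + toℕ t + (toℕ i + toℕ (opposite t)))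
      ∣1+[j+t]+[i+opp[t]] t = subst (m ∣_) (sym (begin
        suc (toℕ j + toℕ t + (toℕ i + toℕ (opposite t)))
          ≡⟨ cong (λ o → suc (toℕ j + toℕ t + (toℕ i + o))) (opposite-prop t) ⟩
        suc (toℕ j + toℕ t + (toℕ i + (L ∸ suc (toℕ t))))
          ≡⟨ rearrange (toℕ i) (toℕ t) (toℕ j) _ ⟩
        toℕ i + (suc (toℕ t) + (L ∸ suc (toℕ t))) + toℕ j
          ≡⟨ cong (λ l → toℕ i + l + toℕ j) (m+[n∸m]≡n (toℕ<n t)) ⟩
        toℕ i + L + toℕ j
          ∎)) i+L+j≡0

    window-negRev-mirror : ∀ L j → window (negRev S) L j ≡ negRevV (window S L (mirror L j))
    window-negRev-mirror L j = window-negRev (opposed-sym {L = L} {i = j} (opposed-mirror L j))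

    windowSeq-negRev : ∀ {L} → IsWindowSeq S L → IsWindowSeq (negRev S) L
    windowSeq-negRev {L} windowSeq j j′ e =
      mirror-injective L (windowSeq _ _ (negRevV-injective (begin
        negRevV (window S L (mirror L j))  ≡⟨ window-negRev-mirror L j ⟨
        window (negRev S) L j              ≡⟨ e ⟩
        window (negRev S) L j′             ≡⟨ window-negRev-mirror L j′ ⟩
        negRevV (window S L (mirror L j′)) ∎)))
      where open ≡-Reasoning

module _ {q m k : ℕ} .{{_ : NonZero q}} .{{_ : NonZero m}}
         (S : Fin m → Fin q) (v : Vec (Fin q) k) where

  occurs? : ∀ i → Dec (window S k i ≡ v)
  occurs? i = ≡-dec _≟_ (window S k i) v

  occurrences : List (Fin m)
  occurrences = filter occurs? (allFin m)

  ∈-occurrences⇔ : ∀ {i} → i ∈ occurrences ⇔ window S k i ≡ v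
  ∈-occurrences⇔ {i} =
    mk⇔ (proj₂ ∘ ∈-filter⁻ occurs? {xs = allFin m}) (∈-filter⁺ occurs? (∈-allFin i))

  windowsˢ : List (Vec (Fin q) (suc k))
  windowsˢ = map (window S (suc k)) occurrences

  windowsᴿ : List (Vec (Fin q) (suc k))
  windowsᴿ = map (window (negRev S) (suc k) ∘ mirror k) occurrences

  pairedWindows : List (Vec (Fin q) (suc k))
  pairedWindows = windowsˢ ++ windowsᴿ

  length-pairedWindows : length pairedWindows ≡ length occurrences + length occurrences
  length-pairedWindows =
    trans (length-++ windowsˢ) (cong₂ _+_ (length-map _ occurrences) (length-map _ occurrences))

  pairedWindows-unique : IsNegOrientable S (suc k) → Unique pairedWindows
  pairedWindows-unique (windowSeq , notNegRev) =
    ++⁺ (map⁺ (windowSeq _ _) occurrences-unique)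
        (map⁺ (mirror-injective k ∘ windowSeq-negRev S windowSeq _ _) occurrences-unique)
        disjoint
    where
    occurrences-unique : Unique occurrences
    occurrences-unique = filter⁺ occurs? (allFin⁺ m)
    disjoint : Disjoint windowsˢ windowsᴿ
    disjoint (u∈ˢ , u∈ᴿ) with i , _ , refl ← ∈-map⁻ _ u∈ˢ | j , _ , e ← ∈-map⁻ _ u∈ᴿ =
      notNegRev i (mirror (suc k) (mirror k j))
        (trans e (window-negRev-mirror S (suc k) (mirror k j)))

  ∈-pairedWindows⇔ : Negasymmetric v → ∀ {u} → u ∈ pairedWindows ⇔ InLStar S v u
  ∈-pairedWindows⇔ negasym = mk⇔ ⊆InLStar InLStar⊆
    where
    v-fixed : negRevV v ≡ v
    v-fixed = negasymmetric⇒negRevV≡ negasym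

    ⊆InLStar : ∀ {u} → u ∈ pairedWindows → InLStar S v u
    ⊆InLStar u∈ with ∈-++⁻ windowsˢ u∈
    ... | inj₁ u∈ˢ with i , i∈ , refl ← ∈-map⁻ _ u∈ˢ =
      from (InL-window v S i) (to ∈-occurrences⇔ i∈) , inj₁ (i , refl)
    ... | inj₂ u∈ᴿ with i , i∈ , refl ← ∈-map⁻ _ u∈ᴿ =
      from (InL-window v (negRev S) (mirror k i)) mirror-occurs , inj₂ (mirror k i , refl)
      where
      open ≡-Reasoning
      mirror-occurs : window (negRev S) k (mirror k i) ≡ v
      mirror-occurs = begin
        window (negRev S) k (mirror k i) ≡⟨ window-negRev S (opposed-mirror k i) ⟩
        negRevV (window S k i)           ≡⟨ cong negRevV (to ∈-occurrences⇔ i∈) ⟩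
        negRevV v                        ≡⟨ v-fixed ⟩
        v                                ∎

    InLStar⊆ : ∀ {u} → InLStar S v u → u ∈ pairedWindows
    InLStar⊆ (inL , inj₁ (i , refl)) =
      ∈-++⁺ˡ (∈-map⁺ _ (from ∈-occurrences⇔ (to (InL-window v S i) inL)))
    InLStar⊆ (inL , inj₂ (j , refl)) =
      ∈-++⁺ʳ windowsˢ (subst (_∈ windowsᴿ) (cong (window (negRev S) (suc k)) (mirror-involutive k j))
                                         (∈-map⁺ _ (from ∈-occurrences⇔ mirror-occurs)))
      where
      open ≡-Reasoning
      mirror-occurs : window S k (mirror k j) ≡ v
      mirror-occurs = negRevV-injective (begin
        negRevV (window S k (mirror k j)) ≡⟨ window-negRev-mirror S k j ⟨
        window (negRev S) k j             ≡⟨ to (InL-window v (negRev S) j) inL ⟩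
        v                                 ≡⟨ v-fixed ⟨
        negRevV v                         ∎)

lemma4 : (q m k : ℕ) → .{{_ : NonZero q}} → .{{_ : NonZero m}} → 2 ≤ q → 1 ≤ k →
         (S : Fin m → Fin q) → IsNegOrientable S (suc k) →
         (v : Vec (Fin q) k) → Negasymmetric v →
         (xs : List (Vec (Fin q) (suc k))) → Unique xs →
         (∀ u → (u ∈ xs) ⇔ InLStar S v u) →
         2 ∣ length xs
lemma4 q m k _ _ S orientable v negasym xs xs-unique xs⇔ = divides c (begin
  length xs                  ≡⟨ unique∧set⇒length≡ xs-unique paired-unique xs⇔paired ⟩
  length (pairedWindows S v) ≡⟨ length-pairedWindows S v ⟩
  c + c                      ≡⟨ cong (c +_) (+-identityʳ c) ⟨
  2 * c                      ≡⟨ *-comm 2 c ⟩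
  c * 2                      ∎)
  where
  open ≡-Reasoning
  c : ℕ
  c = length (occurrences S v)
  paired-unique : Unique (pairedWindows S v)
  paired-unique = pairedWindows-unique S v orientable
  xs⇔paired : ∀ {u} → u ∈ xs ⇔ u ∈ pairedWindows S v
  xs⇔paired {u} = ⇔-trans (xs⇔ u) (⇔-sym (∈-pairedWindows⇔ S v negasym))
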